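{- Let $0<\delta<1$ and let $L$ be an integer with $L>\delta^{ -1}$. Let $r$ be an integer and assume that the set $\mathcal{X}\subset\{r+1,r+2,\ldots,r+L\}$ of integers satisfies $|\mathcal{X}|\ge\delta L$. Then for any positive integer $k$ with $\delta^{ -k}<L$ there exist elements $x_1,x_2\in\mathcal{X}$ such that $$\frac{\delta^{ -(k-1)}}{2}\le x_1-x_2<2\delta^{ -k}.$$
   Formalization: The parameter δ is a rational number with $0<\delta<1$. -}

module Defs where

open import Data.Nat using (ℕ; zero; suc)
open import Data.Integer using (ℤ)
open import Data.Rational using (ℚ; 1ℚ; 0ℚ; _*_; _<_; 1/_; >-nonZero; _/_)

_^_ : ℚ → ℕ → ℚ
p ^ zero = 1ℚ
p ^ suc n = p * (p ^ n)

infixr 8 _^_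

inv : (δ : ℚ) → 0ℚ < δ → ℚ
inv δ δ>0 = (1/ δ) {{>-nonZero δ>0}}

toℚ : ℤ → ℚ
toℚ z = z / 1

{-# OPTIONS --safe #-}
module Submission where

-- Write D = δ⁻¹, a = ⌊Dᵏ⁻¹⌋ and c + 1 = ⌈2Dᵏ⌉.  A difference x₁ - x₂ in [a, c + 1) satisfies
-- Dᵏ⁻¹/2 ≤ x₁ - x₂ < 2Dᵏ, so suppose X has no such difference.  Then the points of X in a
-- window of c + 1 consecutive integers all lie less than a above the least of them, so the
-- window holds at most a of them; covering {r+1, …, r+L} by n + 1 windows with n(c + 1) < L
-- gives |X| ≤ (n + 1)a ≤ (n + 1)Dᵏ⁻¹.  But (n + 1)Dᵏ < L: for n = 0 this is Dᵏ < L, and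
-- otherwise (n + 1)Dᵏ ≤ 2nDᵏ ≤ n(c + 1) < L.  Hence |X| < δL, contradicting the density of X.

open import Defs
open import Data.Nat using (ℕ; _∸_)
open import Data.Integer using (ℤ; +_; _-_)
open import Data.Rational using (ℚ; 0ℚ; 1ℚ; _<_; _≤_; _*_; _/_)
open import Data.Product using (_×_; ∃₂)
open import Data.List using (List; length)
open import Data.List.Membership.Propositional using (_∈_)
open import Data.List.Relation.Unary.All using (All)
open import Data.List.Relation.Unary.Unique.Propositional using (Unique)
import Data.Integer as ℤ
import Data.Nat as ℕ

open import Level using (Level)
open import Function using (case_of_)
open import Data.Empty using (⊥-elim)
open import Data.Nat using (zero; suc; z≤n; s≤s; NonZero)
open import Data.Nat.DivMod using (m≡m%n+[m/n]*n; m%n<n; m/n*n≤m)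
import Data.Nat.Properties as ℕₚ
open import Data.Integer using (-[1+_]; +≤+; +<+; -<+)
import Data.Integer.Properties as ℤₚ
import Data.Integer.Solver as ℤ-Solver
open import Data.Rational using (_+_; mkℚ; *≤*; *<*; positive; nonNegative; >-nonZero)
open import Data.Rational.Literals using (fromℤ)
import Data.Rational.Properties as ℚₚ
import Data.Rational.Solver as ℚ-Solver
open import Data.Product using (∃; _,_; proj₁; proj₂)
open import Data.Sum using (_⊎_; inj₁; inj₂)
open import Data.List using ([]; _∷_; _++_; filter; applyUpTo)
import Data.List.Properties as Listₚ
open import Data.List.Extrema ℤₚ.≤-totalOrder using (min; argmin-all; min≤⊤; min≤xs)
open import Data.List.Membership.Propositional using (find; lose)
open import Data.List.Membership.Propositional.Properties
  using (∈-∃++; ∈-++⁻; ∈-++⁺ˡ; ∈-++⁺ʳ; ∈-applyUpTo⁺)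
open import Data.List.Relation.Binary.Subset.Propositional using (_⊆_)
open import Data.List.Relation.Binary.Subset.Propositional.Properties using (filter-⊆)
open import Data.List.Relation.Unary.Any using (here; there; any?)
import Data.List.Relation.Unary.All as All
import Data.List.Relation.Unary.All.Properties as Allₚ
open import Data.List.Relation.Unary.AllPairs using (_∷_)
import Data.List.Relation.Unary.Unique.Propositional.Properties as Uniqueₚ
open import Relation.Nullary using (¬_; yes; no)
open import Relation.Nullary.Decidable using (_×-dec_)
open import Relation.Unary using (Pred; Decidable)
open import Relation.Unary.Properties using (∁?)
open import Relation.Binary.PropositionalEquality

private
  variable
    ℓ ℓ′ : Level
    A : Set ℓ
    i j k : ℤ
    p q : ℚ

i+j-i≡j : ∀ i j → i ℤ.+ j - i ≡ j
i+j-i≡j = solve 2 (λ i j → i :+ j :- i := j) refl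
  where open ℤ-Solver.+-*-Solver

i+[j-i]≡j : ∀ i j → i ℤ.+ (j - i) ≡ j
i+[j-i]≡j = solve 2 (λ i j → i :+ (j :- i) := j) refl
  where open ℤ-Solver.+-*-Solver

i+j≤k⇒j≤k-i : i ℤ.+ j ℤ.≤ k → j ℤ.≤ k - i
i+j≤k⇒j≤k-i {i} {j} i+j≤k = subst (ℤ._≤ _) (i+j-i≡j i j) (ℤₚ.+-monoˡ-≤ (ℤ.- i) i+j≤k)

k<i+j⇒k-i<j : k ℤ.< i ℤ.+ j → k - i ℤ.< j
k<i+j⇒k-i<j {k} {i} {j} k<i+j = subst (k - i ℤ.<_) (i+j-i≡j i j) (ℤₚ.+-monoˡ-< (ℤ.- i) k<i+j)

unique-⊆⇒length≤ : {xs ys : List A} → Unique xs → xs ⊆ ys → length xs ℕ.≤ length ys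
unique-⊆⇒length≤ {xs = []}     _            _      = z≤n
unique-⊆⇒length≤ {xs = x ∷ xs} (x∉xs ∷ xs!) x∷xs⊆ys with ∈-∃++ (x∷xs⊆ys (here refl))
... | us , vs , refl = begin
  suc (length xs)          ≤⟨ s≤s (unique-⊆⇒length≤ xs! xs⊆us++vs) ⟩
  suc (length (us ++ vs))  ≡⟨ Listₚ.length-++-sucʳ us x vs ⟨
  length (us ++ x ∷ vs)    ∎
  where
  open ℕₚ.≤-Reasoning
  xs⊆us++vs : xs ⊆ us ++ vs
  xs⊆us++vs y∈xs with ∈-++⁻ us (x∷xs⊆ys (there y∈xs))
  ... | inj₁ y∈us         = ∈-++⁺ˡ y∈us
  ... | inj₂ (here y≡x)   = ⊥-elim (All.lookup x∉xs y∈xs (sym y≡x))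
  ... | inj₂ (there y∈vs) = ∈-++⁺ʳ us y∈vs

length-filter+∁ : {P : Pred A ℓ′} (P? : Decidable P) (xs : List A) →
                  length xs ≡ length (filter P? xs) ℕ.+ length (filter (∁? P?) xs)
length-filter+∁ P? []       = refl
length-filter+∁ P? (x ∷ xs) with P? x
... | yes _ = cong suc (length-filter+∁ P? xs)
... | no  _ = trans (cong suc (length-filter+∁ P? xs)) (sym (ℕₚ.+-suc _ _))

m<[1+m/n]*n : ∀ m n .{{_ : NonZero n}} → m ℕ.< suc (m ℕ./ n) ℕ.* n
m<[1+m/n]*n m n = begin-strict
  m                              ≡⟨ m≡m%n+[m/n]*n m n ⟩
  m ℕ.% n ℕ.+ (m ℕ./ n) ℕ.* n    <⟨ ℕₚ.+-monoˡ-< ((m ℕ./ n) ℕ.* n) (m%n<n m n) ⟩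
  n ℕ.+ (m ℕ./ n) ℕ.* n          ∎
  where open ℕₚ.≤-Reasoning

Between : ℤ → ℤ → ℤ → Set
Between s t y = s ℤ.≤ y × y ℤ.< t

between? : ∀ s t → Decidable (Between s t)
between? s t y = s ℤ.≤? y ×-dec y ℤ.<? t

≤∧≤⇒Between : ∀ {s n y} → s ℤ.+ + 1 ℤ.≤ y → y ℤ.≤ s ℤ.+ + n →
              Between (s ℤ.+ + 1) (s ℤ.+ + 1 ℤ.+ + n) y
≤∧≤⇒Between {s} {n} s+1≤y y≤s+n = s+1≤y , subst (_ ℤ.<_) (sym (ℤₚ.+-assoc s (+ 1) (+ n)))
  (ℤₚ.≤-<-trans y≤s+n (ℤₚ.+-monoʳ-< s (+<+ (ℕₚ.n<1+n n))))

length-Between : ∀ n {s} {Y : List ℤ} → Unique Y → All (Between s (s ℤ.+ + n)) Y →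
                 length Y ℕ.≤ n
length-Between n {s} {Y} Y! Y∈window =
  subst (length Y ℕ.≤_) (Listₚ.length-applyUpTo (λ i → s ℤ.+ + i) n)
    (unique-⊆⇒length≤ Y! (λ y∈Y → ∈-window (All.lookup Y∈window y∈Y)))
  where
  ∈-window : ∀ {y} → Between s (s ℤ.+ + n) y → y ∈ applyUpTo (λ i → s ℤ.+ + i) n
  ∈-window {y} (s≤y , y<s+n) =
    subst (_∈ _) s+∣s-y∣≡y (∈-applyUpTo⁺ (λ i → s ℤ.+ + i) ∣s-y∣<n)
    where
    ∣s-y∣≡y-s : + ℤ.∣ s - y ∣ ≡ y - s
    ∣s-y∣≡y-s = ℤₚ.∣-∣-≤ s≤y
    s+∣s-y∣≡y : s ℤ.+ + ℤ.∣ s - y ∣ ≡ y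
    s+∣s-y∣≡y = trans (cong (λ d → s ℤ.+ d) ∣s-y∣≡y-s) (i+[j-i]≡j s y)
    ∣s-y∣<n : ℤ.∣ s - y ∣ ℕ.< n
    ∣s-y∣<n with +<+ lt ← subst (ℤ._< + n) (sym ∣s-y∣≡y-s) (k<i+j⇒k-i<j y<s+n) = lt

GapFree : ℕ → ℕ → List ℤ → Set
GapFree a c Y = ∀ {x y} → x ∈ Y → y ∈ Y → ¬ Between (y ℤ.+ + a) (y ℤ.+ + c) x

gapFree-⊆ : ∀ {a c} {Y Z : List ℤ} → Z ⊆ Y → GapFree a c Y → GapFree a c Z
gapFree-⊆ Z⊆Y gapFree x∈Z y∈Z = gapFree (Z⊆Y x∈Z) (Z⊆Y y∈Z)

gap-or-gapFree : ∀ a c (Y : List ℤ) →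
                 (∃₂ λ x y → x ∈ Y × y ∈ Y × Between (y ℤ.+ + a) (y ℤ.+ + c) x) ⊎ GapFree a c Y
gap-or-gapFree a c Y with any? (λ x → any? (λ y → between? (y ℤ.+ + a) (y ℤ.+ + c) x) Y) Y
... | no ¬gap = inj₂ λ x∈Y y∈Y gap → ¬gap (lose x∈Y (lose y∈Y gap))
... | yes gap with find gap
...   | x , x∈Y , gapₓ with find gapₓ
...     | y , y∈Y , gapₓᵧ = inj₁ (x , y , x∈Y , y∈Y , gapₓᵧ)

length-gapFree-Between : ∀ {a c s} {Y : List ℤ} → GapFree a c Y → Unique Y →
                         All (Between s (s ℤ.+ + c)) Y → length Y ℕ.≤ a
length-gapFree-Between {Y = []} _ _ _ = z≤n
length-gapFree-Between {a} {c} {s} {Y = y ∷ ys} gapFree Y! Y∈window =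
  length-Between a Y! (All.tabulate near-μ)
  where
  μ : ℤ
  μ = min y ys
  μ∈Y : μ ∈ y ∷ ys
  μ∈Y = argmin-all (λ z → z) (here refl) (All.tabulate there)
  μ≤Y : All (μ ℤ.≤_) (y ∷ ys)
  μ≤Y = min≤⊤ y ys All.∷ min≤xs y ys
  near-μ : ∀ {z} → z ∈ y ∷ ys → Between μ (μ ℤ.+ + a) z
  near-μ z∈Y = All.lookup μ≤Y z∈Y , ℤₚ.≰⇒> λ μ+a≤z → gapFree z∈Y μ∈Y (μ+a≤z , z<μ+c)
    where
    z<μ+c = ℤₚ.<-≤-trans (proj₂ (All.lookup Y∈window z∈Y))
                         (ℤₚ.+-monoˡ-≤ (+ c) (proj₁ (All.lookup Y∈window μ∈Y)))

length-gapFree-blocks : ∀ q {a c s} {Y : List ℤ} → GapFree a c Y → Unique Y →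
                        All (Between s (s ℤ.+ + (q ℕ.* c))) Y → length Y ℕ.≤ q ℕ.* a
length-gapFree-blocks zero    _ Y! Y∈window = length-Between 0 Y! Y∈window
length-gapFree-blocks (suc q) {a} {c} {s} {Y} gapFree Y! Y∈window = begin
  length Y                                             ≡⟨ length-filter+∁ P? Y ⟩
  length (filter P? Y) ℕ.+ length (filter (∁? P?) Y)   ≤⟨ ℕₚ.+-mono-≤ first rest ⟩
  a ℕ.+ q ℕ.* a                                        ∎
  where
  open ℕₚ.≤-Reasoning
  P? : Decidable (ℤ._< s ℤ.+ + c)
  P? y = y ℤ.<? s ℤ.+ + c
  first = length-gapFree-Between (gapFree-⊆ (filter-⊆ P? Y) gapFree)
    (Uniqueₚ.filter⁺ P? Y!)
    (All.zip (Allₚ.filter⁺ P? (All.map proj₁ Y∈window) , Allₚ.all-filter P? Y))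
  rest = length-gapFree-blocks q (gapFree-⊆ (filter-⊆ (∁? P?) Y) gapFree)
    (Uniqueₚ.filter⁺ (∁? P?) Y!)
    (All.zip (All.map ℤₚ.≮⇒≥ (Allₚ.all-filter (∁? P?) Y) ,
              Allₚ.filter⁺ (∁? P?) (All.map (λ (_ , y<t) → subst (_ ℤ.<_)
                (sym (ℤₚ.+-assoc s (+ c) (+ (q ℕ.* c)))) y<t) Y∈window)))

length-gapFree-window : ∀ l {a c s} {Y : List ℤ} .{{_ : NonZero c}} → GapFree a c Y → Unique Y →
                        All (Between s (s ℤ.+ + suc l)) Y → length Y ℕ.≤ suc (l ℕ./ c) ℕ.* a
length-gapFree-window l {c = c} {s} gapFree Y! Y∈window =
  length-gapFree-blocks (suc (l ℕ./ c)) gapFree Y! (All.map widen Y∈window)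
  where
  widen : ∀ {y} → Between s (s ℤ.+ + suc l) y → Between s (s ℤ.+ + (suc (l ℕ./ c) ℕ.* c)) y
  widen (s≤y , y<s+1+l) = s≤y , ℤₚ.<-≤-trans y<s+1+l (ℤₚ.+-monoʳ-≤ s (+≤+ (m<[1+m/n]*n l c)))

toℚ≡fromℤ : ∀ i → toℚ i ≡ fromℤ i
toℚ≡fromℤ i = ℚₚ.↥p/↧p≡p (fromℤ i)

toℚ-mono-≤ : i ℤ.≤ j → toℚ i ≤ toℚ j
toℚ-mono-≤ {i} {j} i≤j rewrite toℚ≡fromℤ i | toℚ≡fromℤ j =
  *≤* (ℤₚ.*-monoʳ-≤-nonNeg ℤ.1ℤ i≤j)

toℚ-mono-< : i ℤ.< j → toℚ i < toℚ j
toℚ-mono-< {i} {j} i<j rewrite toℚ≡fromℤ i | toℚ≡fromℤ j =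
  *<* (ℤₚ.*-monoʳ-<-pos ℤ.1ℤ i<j)

toℚ-cancel-< : toℚ i < toℚ j → i ℤ.< j
toℚ-cancel-< {i} {j} rewrite toℚ≡fromℤ i | toℚ≡fromℤ j =
  λ { (*<* i<j) → ℤₚ.*-cancelʳ-<-nonNeg ℤ.1ℤ i<j }

toℚ-homo-+ : ∀ i j → toℚ (i ℤ.+ j) ≡ toℚ i + toℚ j
toℚ-homo-+ i j rewrite toℚ≡fromℤ i | toℚ≡fromℤ j =
  cong₂ (λ m n → toℚ (m ℤ.+ n)) (sym (ℤₚ.*-identityʳ i)) (sym (ℤₚ.*-identityʳ j))

toℚ-homo-* : ∀ i j → toℚ (i ℤ.* j) ≡ toℚ i * toℚ j
toℚ-homo-* i j rewrite toℚ≡fromℤ i | toℚ≡fromℤ j = refl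

toℚ-pos-* : ∀ m n → toℚ (+ (m ℕ.* n)) ≡ toℚ (+ m) * toℚ (+ n)
toℚ-pos-* m n = trans (cong toℚ (ℤₚ.pos-* m n)) (toℚ-homo-* (+ m) (+ n))

archimedean : ∀ p → ∃ λ N → p < toℚ (+ N)
archimedean (mkℚ -[1+ n ] _ _) = 0 , *<* -<+
archimedean p@(mkℚ (+ n) d _) = suc n , subst (p <_) (sym (toℚ≡fromℤ (+ suc n)))
  (*<* (subst₂ ℤ._<_ (sym (ℤₚ.*-identityʳ (+ n))) (ℤₚ.pos-* (suc n) (suc d))
          (+<+ (ℕₚ.<-≤-trans (ℕₚ.n<1+n n) (ℕₚ.m≤m*n (suc n) (suc d))))))

∃-floor : 0ℚ ≤ p → ∃ λ a → toℚ (+ a) ≤ p × p < toℚ (+ suc a)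
∃-floor {p} 0≤p = let N , p<N = archimedean p in search N p<N
  where
  search : ∀ N → p < toℚ (+ N) → ∃ λ a → toℚ (+ a) ≤ p × p < toℚ (+ suc a)
  search zero    p<0 = ⊥-elim (ℚₚ.<-irrefl refl (ℚₚ.≤-<-trans 0≤p p<0))
  search (suc N) p<1+N with p ℚₚ.<? toℚ (+ N)
  ... | yes p<N = search N p<N
  ... | no  p≮N = N , ℚₚ.≮⇒≥ p≮N , p<1+N

∃-ceiling : 0ℚ < p → ∃ λ c → toℚ (+ c) < p × p ≤ toℚ (+ suc c)
∃-ceiling {p} 0<p = let N , p<N = archimedean p in search N (ℚₚ.<⇒≤ p<N)
  where
  search : ∀ N → p ≤ toℚ (+ N) → ∃ λ c → toℚ (+ c) < p × p ≤ toℚ (+ suc c)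
  search zero    p≤0 = ⊥-elim (ℚₚ.<-irrefl refl (ℚₚ.<-≤-trans 0<p p≤0))
  search (suc N) p≤1+N with p ℚₚ.≤? toℚ (+ N)
  ... | yes p≤N = search N p≤N
  ... | no  p≰N = N , ℚₚ.≰⇒> p≰N , p≤1+N

1≤⇒0< : 1ℚ ≤ p → 0ℚ < p
1≤⇒0< = ℚₚ.<-≤-trans (ℚₚ.positive⁻¹ 1ℚ)

q≤p*q : 1ℚ ≤ p → 0ℚ ≤ q → q ≤ p * q
q≤p*q {p} {q} 1≤p 0≤q =
  subst (_≤ p * q) (ℚₚ.*-identityˡ q) (ℚₚ.*-monoʳ-≤-nonNeg q {{nonNegative 0≤q}} 1≤p)

1≤^ : 1ℚ ≤ p → ∀ n → 1ℚ ≤ p ^ n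
1≤^ 1≤p zero    = ℚₚ.≤-refl
1≤^ 1≤p (suc n) = ℚₚ.≤-trans (1≤^ 1≤p n) (q≤p*q 1≤p (ℚₚ.<⇒≤ (1≤⇒0< (1≤^ 1≤p n))))

½ : ℚ
½ = + 1 / 2

half-≤ : ∀ {e a} → 1ℚ ≤ e → e < toℚ (+ suc a) → e * ½ ≤ toℚ (+ a)
half-≤ {e} {a} 1≤e e<1+a = begin
  e * ½                          ≤⟨ ℚₚ.*-monoʳ-≤-nonNeg ½ (ℚₚ.<⇒≤ e<1+a) ⟩
  toℚ (+ suc a) * ½              ≤⟨ ℚₚ.*-monoʳ-≤-nonNeg ½ (toℚ-mono-≤ (+≤+ (ℕₚ.+-monoˡ-≤ a 1≤a))) ⟩
  toℚ (+ (a ℕ.+ a)) * ½          ≡⟨ cong (_* ½) (toℚ-homo-+ (+ a) (+ a)) ⟩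
  (toℚ (+ a) + toℚ (+ a)) * ½    ≡⟨ solve 1 (λ x → (x :+ x) :* con ½ := x) refl (toℚ (+ a)) ⟩
  toℚ (+ a)                      ∎
  where
  open ℚₚ.≤-Reasoning
  open ℚ-Solver.+-*-Solver
  1≤a : 1 ℕ.≤ a
  1≤a with +<+ (s≤s 1≤a) ← toℚ-cancel-< {+ 1} {+ suc a} (ℚₚ.≤-<-trans 1≤e e<1+a) = 1≤a

gap⇒bounds : ∀ {e p a c x y} → 1ℚ ≤ e → e < toℚ (+ suc a) → toℚ (+ c) < p →
             Between (y ℤ.+ + a) (y ℤ.+ + suc c) x → e * ½ ≤ toℚ (x - y) × toℚ (x - y) < p
gap⇒bounds {a = a} 1≤e e<1+a c<p (y+a≤x , x<y+1+c) =
  ℚₚ.≤-trans (half-≤ {a = a} 1≤e e<1+a) (toℚ-mono-≤ (i+j≤k⇒j≤k-i y+a≤x)) ,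
  ℚₚ.≤-<-trans (toℚ-mono-≤ (ℤₚ.i<j⇒i≤pred[j] (k<i+j⇒k-i<j x<y+1+c))) c<p

[1+n]*p<l : ∀ n {c l p} → 0ℚ ≤ p → p < toℚ (+ l) → (+ 2 / 1) * p ≤ toℚ (+ c) →
            n ℕ.* c ℕ.< l → toℚ (+ suc n) * p < toℚ (+ l)
[1+n]*p<l zero    {p = p} _ p<l _ _ = subst (_< _) (sym (ℚₚ.*-identityˡ p)) p<l
[1+n]*p<l (suc n) {c} {l} {p} 0≤p _ 2p≤c [1+n]c<l = begin-strict
  toℚ (+ suc (suc n)) * p   ≡⟨ cong (_* p) (toℚ-homo-+ (+ 1) (+ suc n)) ⟩
  (1ℚ + t) * p              ≤⟨ ℚₚ.*-monoʳ-≤-nonNeg p {{nonNegative 0≤p}} (ℚₚ.+-monoˡ-≤ t 1≤t) ⟩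
  (t + t) * p               ≡⟨ solve 2 (λ t p → (t :+ t) :* p := t :* (con (+ 2 / 1) :* p)) refl t p ⟩
  t * ((+ 2 / 1) * p)       ≤⟨ ℚₚ.*-monoˡ-≤-nonNeg t {{nonNegative (ℚₚ.<⇒≤ (1≤⇒0< 1≤t))}} 2p≤c ⟩
  t * toℚ (+ c)             ≡⟨ toℚ-pos-* (suc n) c ⟨
  toℚ (+ (suc n ℕ.* c))     <⟨ toℚ-mono-< (+<+ [1+n]c<l) ⟩
  toℚ (+ l)                 ∎
  where
  open ℚₚ.≤-Reasoning
  open ℚ-Solver.+-*-Solver
  t = toℚ (+ suc n)
  1≤t : 1ℚ ≤ t
  1≤t = toℚ-mono-≤ {+ 1} {+ suc n} (+≤+ (s≤s z≤n))

module _ {δ : ℚ} (δ>0 : 0ℚ < δ) where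

  private
    instance
      δ-positive = positive δ>0
      δ-nonZero  = >-nonZero δ>0

  δ*inv≡1 : δ * inv δ δ>0 ≡ 1ℚ
  δ*inv≡1 = ℚₚ.*-inverseʳ δ

  1≤inv : δ < 1ℚ → 1ℚ ≤ inv δ δ>0
  1≤inv δ<1 = ℚₚ.*-cancelˡ-≤-pos δ
    (subst₂ _≤_ (sym (ℚₚ.*-identityʳ δ)) (sym δ*inv≡1) (ℚₚ.<⇒≤ δ<1))

  0<inv^ : δ < 1ℚ → ∀ n → 0ℚ < inv δ δ>0 ^ n
  0<inv^ δ<1 n = 1≤⇒0< (1≤^ (1≤inv δ<1) n)

  gapFree⇒sparse : ∀ l {a c s e} {Y : List ℤ} → GapFree a (suc c) Y → Unique Y →
                   All (Between s (s ℤ.+ + suc l)) Y → toℚ (+ a) ≤ e →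
                   0ℚ ≤ inv δ δ>0 * e → inv δ δ>0 * e < toℚ (+ suc l) →
                   (+ 2 / 1) * (inv δ δ>0 * e) ≤ toℚ (+ suc c) →
                   toℚ (+ length Y) < δ * toℚ (+ suc l)
  gapFree⇒sparse l {a} {c} {e = e} {Y} gapFree Y! Y∈window a≤e 0≤De De<L 2De≤1+c = begin-strict
    toℚ (+ length Y)              ≤⟨ toℚ-mono-≤ (+≤+ (length-gapFree-window l gapFree Y! Y∈window)) ⟩
    toℚ (+ (suc n ℕ.* a))         ≡⟨ toℚ-pos-* (suc n) a ⟩
    t * toℚ (+ a)                 ≤⟨ ℚₚ.*-monoˡ-≤-nonNeg t {{nonNegative 0≤t}} a≤e ⟩
    t * e                         ≡⟨ cong (t *_) (ℚₚ.*-identityˡ e) ⟨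
    t * (1ℚ * e)                  ≡⟨ cong (λ x → t * (x * e)) δ*inv≡1 ⟨
    t * (δ * inv δ δ>0 * e)       ≡⟨ solve 4 (λ t δ D e → t :* (δ :* D :* e) := δ :* (t :* (D :* e)))
                                           refl t δ (inv δ δ>0) e ⟩
    δ * (t * (inv δ δ>0 * e))     <⟨ ℚₚ.*-monoʳ-<-pos δ (
                                       [1+n]*p<l n 0≤De De<L 2De≤1+c (s≤s (m/n*n≤m l (suc c)))) ⟩
    δ * toℚ (+ suc l)             ∎
    where
    open ℚₚ.≤-Reasoning
    open ℚ-Solver.+-*-Solver
    n = l ℕ./ suc c
    t = toℚ (+ suc n)
    0≤t : 0ℚ ≤ t
    0≤t = toℚ-mono-≤ {+ 0} {+ suc n} (+≤+ z≤n)

lemma6 : (δ : ℚ) (δ>0 : 0ℚ < δ) → δ < 1ℚ →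
         (L : ℤ) → inv δ δ>0 < toℚ L →
         (r : ℤ) (X : List ℤ) → Unique X →
         All (λ x → (r ℤ.+ + 1 ℤ.≤ x) × (x ℤ.≤ r ℤ.+ L)) X →
         δ * toℚ L ≤ toℚ (+ length X) →
         (k : ℕ) → 1 ℕ.≤ k → inv δ δ>0 ^ k < toℚ L →
         ∃₂ λ x₁ x₂ → x₁ ∈ X × x₂ ∈ X ×
           ((inv δ δ>0 ^ (k ∸ 1)) * (+ 1 / 2) ≤ toℚ (x₁ - x₂)) ×
           (toℚ (x₁ - x₂) < (+ 2 / 1) * (inv δ δ>0 ^ k))
lemma6 _ _ _ _ _ _ _ _ _ _ zero () _
lemma6 δ δ>0 δ<1 -[1+ m ] _ _ _ _ _ _ (suc k) _ Dᵏ⁺¹<L =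
  ⊥-elim (ℚₚ.<-asym Dᵏ⁺¹<L (ℚₚ.<-trans (toℚ-mono-< { -[1+ m ]} {+ 0} -<+) (0<inv^ δ>0 δ<1 (suc k))))
lemma6 δ δ>0 δ<1 (+ zero) _ _ _ _ _ _ (suc k) _ Dᵏ⁺¹<0 =
  ⊥-elim (ℚₚ.<-asym Dᵏ⁺¹<0 (0<inv^ δ>0 δ<1 (suc k)))
lemma6 δ δ>0 δ<1 (+ suc l) _ r X X! X⊆[r+1,r+L] δL≤|X| (suc k) _ Dᵏ⁺¹<L =
  let a , a≤Dᵏ , Dᵏ<1+a = ∃-floor (ℚₚ.<⇒≤ (1≤⇒0< 1≤Dᵏ))
      c , c<2Dᵏ⁺¹ , 2Dᵏ⁺¹≤1+c = ∃-ceiling 0<2Dᵏ⁺¹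
  in case gap-or-gapFree a (suc c) X of λ where
    (inj₁ (x₁ , x₂ , x₁∈X , x₂∈X , gap)) →
      x₁ , x₂ , x₁∈X , x₂∈X , gap⇒bounds {a = a} {c} 1≤Dᵏ Dᵏ<1+a c<2Dᵏ⁺¹ gap
    (inj₂ gapFree) → ⊥-elim (ℚₚ.<-irrefl refl (ℚₚ.<-≤-trans
      (gapFree⇒sparse δ>0 l {a} {c} {e = inv δ δ>0 ^ k} gapFree X! X∈window a≤Dᵏ
         (ℚₚ.<⇒≤ 0<Dᵏ⁺¹) Dᵏ⁺¹<L 2Dᵏ⁺¹≤1+c)
      δL≤|X|))
  where
  1≤Dᵏ : 1ℚ ≤ inv δ δ>0 ^ k
  1≤Dᵏ = 1≤^ (1≤inv δ>0 δ<1) k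
  0<Dᵏ⁺¹ : 0ℚ < inv δ δ>0 ^ suc k
  0<Dᵏ⁺¹ = 0<inv^ δ>0 δ<1 (suc k)
  0<2Dᵏ⁺¹ : 0ℚ < (+ 2 / 1) * inv δ δ>0 ^ suc k
  0<2Dᵏ⁺¹ = ℚₚ.<-≤-trans 0<Dᵏ⁺¹ (q≤p*q (toℚ-mono-≤ {+ 1} {+ 2} (+≤+ (s≤s z≤n))) (ℚₚ.<⇒≤ 0<Dᵏ⁺¹))
  X∈window : All (Between (r ℤ.+ + 1) (r ℤ.+ + 1 ℤ.+ + suc l)) X
  X∈window = All.map (λ (r+1≤x , x≤r+L) → ≤∧≤⇒Between {r} r+1≤x x≤r+L) X⊆[r+1,r+L]
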